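{- Let $\gamma\in(\frac12,1)$ and $m=m(n)$ with $m\sim\gamma\binom{n}{2}$. For almost all $(G,\{A,B\})\in\mathrm{Cov}_{n,m}$, the bipartition $\{A,B\}$ is almost equitable; that is, $$|\mathrm{Cov}_{n,m}|\sim\sum_{\{A,B\}}\binom{|A|\cdot|B|}{m-\binom{|A|}{2}-\binom{|B|}{2}},$$ where the sum is over almost-equitable bipartitions $\{A,B\}$ of $V=\{1,\dots,n\}$.
   Context: $V=\{1,\dots,n\}$. $\mathrm{Cov}_{n,m}$ is the set of pairs $(G,\{A,B\})$ where $G$ is a graph on $V$ with $m$ edges, $V=A\sqcup B$ is an (unordered) bipartition, and $G[A]$ and $G[B]$ are complete graphs. A bipartition $\{A,B\}$ is almost equitable if $||A|-|B||\le\sqrt{\log n}$. "Almost all" means all but a fraction tending to $0$ as $n\to\infty$; $f\sim g$ means $f/g\to1$. -}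

module Defs where

open import Data.Bool using (Bool; true; false; _∧_; _∨_; not; if_then_else_; T)
open import Data.Nat using (ℕ; zero; suc; _+_; _*_; _∸_; _^_; _!; _≤_; _<_; _≥_; _<ᵇ_; _≡ᵇ_; ∣_-_∣)
open import Data.Nat.Combinatorics using (_C_)
open import Data.Nat.ListAction using (sum)
open import Data.Fin using (Fin; toℕ)
open import Data.Vec using (Vec; []; _∷_; lookup)
open import Data.List using (List; []; _∷_; [_]; map; concatMap; length; allFin)
open import Data.Product using (_×_; _,_; Σ; ∃; ∃-syntax)
open import Function.Bundles using (_⇔_)

-- Vertices: V = Fin n.  A graph on V is a subset of the list `pairs n`
-- of all pairs (i , j) with i < j, encoded as a list of Booleans
-- (one bit per pair, in the order of `pairs n`).

pairs : (n : ℕ) → List (Fin n × Fin n)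
pairs n = concatMap (λ i → concatMap (λ j → if toℕ i <ᵇ toℕ j then [ (i , j) ] else []) (allFin n)) (allFin n)

allBools : ℕ → List (List Bool)
allBools zero    = [ [] ]
allBools (suc k) = concatMap (λ l → (true ∷ l) ∷ (false ∷ l) ∷ []) (allBools k)

allSides : (k : ℕ) → List (Vec Bool k)
allSides zero    = [ [] ]
allSides (suc k) = concatMap (λ v → (true ∷ v) ∷ (false ∷ v) ∷ []) (allSides k)

countTrue : List Bool → ℕ
countTrue []           = 0
countTrue (true ∷ bs)  = suc (countTrue bs)
countTrue (false ∷ bs) = countTrue bs

countTrueV : ∀ {k} → Vec Bool k → ℕ
countTrueV []           = 0
countTrueV (true ∷ bs)  = suc (countTrueV bs)
countTrueV (false ∷ bs) = countTrueV bs

anyFalse : ∀ {k} → Vec Bool k → Bool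
anyFalse []       = false
anyFalse (b ∷ bs) = not b ∨ anyFalse bs

-- Unordered bipartitions {A,B} of V (both parts nonempty) are encoded
-- canonically by a vector s : Vec Bool n with A = {v | s v = true},
-- B = {v | s v = false}, where A is the part containing vertex 0.
-- `canonical s` says: vertex 0 is in A and B is nonempty.

canonical : ∀ {n} → Vec Bool n → Bool
canonical []       = false
canonical (b ∷ bs) = b ∧ anyFalse bs

sizeA : ∀ {n} → Vec Bool n → ℕ
sizeA s = countTrueV s

sizeB : ∀ {n} → Vec Bool n → ℕ
sizeB {n} s = n ∸ countTrueV s

sameSide : Bool → Bool → Bool
sameSide b c = (b ∧ c) ∨ (not b ∧ not c)

-- G[A] and G[B] complete: every pair inside one part is an edge of G
coverOK : ∀ {n} → (Fin n → Bool) → List (Fin n × Fin n) → List Bool → Bool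
coverOK side []              _        = true
coverOK side ((i , j) ∷ ps)  []       = false
coverOK side ((i , j) ∷ ps)  (b ∷ bs) = (not (sameSide (side i) (side j)) ∨ b) ∧ coverOK side ps bs

indicator : Bool → ℕ
indicator b = if b then 1 else 0

covCount : ℕ → ℕ → ℕ
covCount n m =
  sum (map (λ s → sum (map (λ g →
         indicator (canonical s ∧ (coverOK (lookup s) (pairs n) g ∧ (countTrue g ≡ᵇ m))))
       (allBools (length (pairs n)))))
     (allSides n))

-- The binomial  binom(|A||B|, m - binom(|A|,2) - binom(|B|,2)),
-- which is 0 when the lower index is negative (and also when it exceeds
-- the upper index, by the stdlib convention of _C_).

crossTerm : ℕ → ℕ → ℕ → ℕ
crossTerm a b m =
  if m <ᵇ (a C 2 + b C 2) then 0 else (a * b) C (m ∸ (a C 2 + b C 2))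

-- Almost equitable: | |A| - |B| | ≤ sqrt(log n)  (natural log), i.e.
-- d^2 ≤ ln n, i.e. e^(d^2) ≤ n.  Since e^k = sup_N Σ_{i≤N} k^i/i!,
-- e^k ≤ n  iff  for all N, Σ_{i≤N} k^i/i! ≤ n  iff  for all N,
-- expScaled k N ≤ n * N!, where expScaled k N = Σ_{i≤N} k^i · N!/i!.

expScaled : ℕ → ℕ → ℕ
expScaled k zero    = 1
expScaled k (suc N) = suc N * expScaled k N + k ^ suc N

AlmostEquitableDist : ℕ → ℕ → Set
AlmostEquitableDist n d = ∀ N → expScaled (d * d) N ≤ n * (N !)

-- A Boolean decider for the (non-obviously decidable) predicate above;
-- the theorem is stated for every correct decider.
AESpec : (ℕ → ℕ → Bool) → Set
AESpec ae = ∀ n d → (T (ae n d) ⇔ AlmostEquitableDist n d)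

aeSum : (ℕ → ℕ → Bool) → ℕ → ℕ → ℕ
aeSum ae n m =
  sum (map (λ s → if canonical s ∧ ae n ∣ sizeA s - sizeB s ∣
                  then crossTerm (sizeA s) (sizeB s) m else 0)
       (allSides n))

-- Hypothesis "m ~ γ·binom(n,2) for some real γ ∈ (1/2,1)", stated without
-- reals: the ratio r(n) = m(n)/binom(n,2) is Cauchy (so it converges to
-- some real γ) and is eventually in [1/2 + 1/(j+1), 1 - 1/(j+1)] for some j
-- (so γ ∈ (1/2,1)); conversely m ~ γ binom(n,2) with γ ∈ (1/2,1) gives both.
-- All inequalities are cross-multiplied to stay in ℕ.

GammaHyp : (ℕ → ℕ) → Set
GammaHyp m =
  (∀ k → ∃[ N ] ∀ p q → p ≥ N → q ≥ N →
      ∣ m p * (q C 2) - m q * (p C 2) ∣ * suc k ≤ (p C 2) * (q C 2))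
  × (∃[ j ] ∃[ N ] ∀ p → p ≥ N →
      ((p C 2) * (j + 3) ≤ 2 * suc j * m p) × (2 * suc j * m p ≤ (p C 2) * (2 * j)))

Asymp : (ℕ → ℕ) → (ℕ → ℕ) → Set
Asymp f g =
  (∃[ N ] ∀ n → n ≥ N → 0 < g n)
  × (∀ k → ∃[ N ] ∀ n → n ≥ N → ∣ f n - g n ∣ * suc k ≤ g n)

-- Counting graphs bipartition by bipartition, a bipartition with
-- |A| = a contributes κ(a) = C(a(n−a), m − C(a,2) − C(n−a,2)) covers, so
-- |Cov_{n,m}| = Σ_a C(n,a)·κ(a) up to the choice of the part containing
-- vertex 0.  If m ≤ (j/(j+1))·C(n,2) then, for a ≥ n/2, the weights
-- w(a) = C(n,a)·κ(a) satisfy w(a+1)·(j+1) ≤ w(a)·j.  A bipartition that is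
-- not almost equitable has a part of size ≥ n/2 + K′, where K′ → ∞ with n,
-- so all of them together weigh at most 2(j+1)·w(c+K′) ≤ 2(j+1)(j/(j+1))^K′·w(c)
-- for the central size c; and w(c) is at most twice the contribution of the
-- bipartitions of size c, which are almost equitable.  The lower bound on m
-- makes that central contribution positive.

module Submission where

open import Defs
open import Data.Nat using (ℕ)
open import Data.Bool using (Bool)
open import Data.Nat.Base
open import Data.Nat.Properties
open import Data.Nat.Combinatorics using (_C_; nCk≡nC[n∸k]; nCn≡1; k>n⇒nCk≡0; nCk+nC[k+1]≡[n+1]C[k+1])
open import Data.Nat.Tactic.RingSolver
open import Data.Bool.Base using (true; false; _∧_; _∨_; not; if_then_else_; T)
open import Data.Bool.Properties using (T-≡; ∧-zeroʳ)
open import Data.List.Base using (List; []; _∷_; [_]; map; concatMap; length; allFin; _++_; tabulate)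
open import Data.List.Properties using (map-++)
open import Data.Nat.ListAction.Properties using (sum-++)
open import Data.Nat.ListAction using (sum)
open import Data.Fin.Base using (Fin; toℕ) renaming (zero to fzero; suc to fsuc)
open import Data.Vec.Base using (Vec; lookup) renaming ([] to []v; _∷_ to _∷v_)
open import Data.Product.Base using (_×_; _,_; proj₁; proj₂)
open import Data.Sum.Base using (inj₁; inj₂)
open import Data.Unit.Base using (tt)
open import Data.Empty using (⊥-elim)
open import Function.Base using (_∘_; id)
open import Function.Bundles using (Equivalence)
open import Relation.Nullary using (Dec; yes; no; ¬_)
open import Relation.Binary.PropositionalEquality hiding ([_])

-- Pascal's recursion: agrees with _C_, but reduces by pattern matching.
binom : ℕ → ℕ → ℕ
binom n       zero    = 1
binom zero    (suc k) = 0
binom (suc n) (suc k) = binom n k + binom n (suc k)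

C≡binom : ∀ n k → n C k ≡ binom n k
C≡binom n       zero    = trans (nCk≡nC[n∸k] {0} {n} z≤n) (nCn≡1 n)
C≡binom zero    (suc k) = k>n⇒nCk≡0 {0} {suc k} (s≤s z≤n)
C≡binom (suc n) (suc k) =
  trans (sym (nCk+nC[k+1]≡[n+1]C[k+1] n k)) (cong₂ _+_ (C≡binom n k) (C≡binom n (suc k)))

n<k⇒binom≡0 : ∀ n k → n < k → binom n k ≡ 0
n<k⇒binom≡0 zero    (suc k) _          = refl
n<k⇒binom≡0 (suc n) (suc k) (s≤s n<k) =
  cong₂ _+_ (n<k⇒binom≡0 n k n<k) (n<k⇒binom≡0 n (suc k) (m<n⇒m<1+n n<k))

k≤n⇒binom>0 : ∀ n k → k ≤ n → 0 < binom n k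
k≤n⇒binom>0 n       zero    _         = s≤s z≤n
k≤n⇒binom>0 (suc n) (suc k) (s≤s k≤n) = ≤-trans (k≤n⇒binom>0 n k k≤n) (m≤m+n _ _)

binom[n,1]≡n : ∀ n → binom n 1 ≡ n
binom[n,1]≡n zero    = refl
binom[n,1]≡n (suc n) = cong suc (binom[n,1]≡n n)

binom[1+n,2] : ∀ n → binom (suc n) 2 ≡ n + binom n 2
binom[1+n,2] n = cong (_+ binom n 2) (binom[n,1]≡n n)

binom-mono-+ : ∀ i n k → binom n k ≤ binom (i + n) (i + k)
binom-mono-+ zero    n k = ≤-refl
binom-mono-+ (suc i) n k = ≤-trans (binom-mono-+ i n k) (m≤m+n _ _)

binom-absorption : ∀ n k → binom (suc n) (suc k) * suc k ≡ binom n k * suc n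
binom-absorption zero    zero    = refl
binom-absorption zero    (suc k) = refl
binom-absorption (suc n) zero    =
  trans (*-identityʳ _) (trans (binom[n,1]≡n (suc (suc n))) (sym (+-identityʳ _)))
binom-absorption (suc n) (suc k) =
  pascal-step (binom (suc n) (suc k)) (binom (suc n) (suc (suc k))) (binom n k) (binom n (suc k))
    (binom-absorption n k) (binom-absorption n (suc k)) refl
  where
  pascal-step : ∀ a b c d → a * suc k ≡ c * suc n → b * suc (suc k) ≡ d * suc n → a ≡ c + d →
                (a + b) * suc (suc k) ≡ a * suc (suc n)
  pascal-step a b c d ak bk a≡c+d = begin
    (a + b) * suc (suc k)              ≡⟨ solve (a ∷ b ∷ k ∷ []) ⟩
    (a * suc k + a) + b * suc (suc k)  ≡⟨ cong₂ (λ u v → (u + a) + v) ak bk ⟩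
    (c * suc n + a) + d * suc n        ≡⟨ solve (a ∷ c ∷ d ∷ n ∷ []) ⟩
    (c + d) * suc n + a                ≡⟨ cong (λ u → u * suc n + a) (sym a≡c+d) ⟩
    a * suc n + a                      ≡⟨ solve (a ∷ n ∷ []) ⟩
    a * suc (suc n)                    ∎
    where open ≡-Reasoning

binom-suc-ratio : ∀ n k → binom n (suc k) * suc k ≡ binom n k * (n ∸ k)
binom-suc-ratio n k with k ≤? n
... | yes k≤n = +-cancelˡ-≡ (binom n k * suc k) _ _ (begin
      binom n k * suc k + binom n (suc k) * suc k ≡⟨ sym (*-distribʳ-+ (suc k) (binom n k) (binom n (suc k))) ⟩
      binom (suc n) (suc k) * suc k               ≡⟨ binom-absorption n k ⟩
      binom n k * suc n                           ≡⟨ cong (λ u → binom n k * suc u) (sym (m+[n∸m]≡n k≤n)) ⟩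
      binom n k * (suc k + (n ∸ k))               ≡⟨ *-distribˡ-+ (binom n k) (suc k) (n ∸ k) ⟩
      binom n k * suc k + binom n k * (n ∸ k)     ∎)
  where open ≡-Reasoning
... | no k≰n = begin
      binom n (suc k) * suc k ≡⟨ cong (_* suc k) (n<k⇒binom≡0 n (suc k) (m<n⇒m<1+n n<k)) ⟩
      0                       ≡⟨ sym (*-zeroʳ (binom n k)) ⟩
      binom n k * 0           ≡⟨ cong (binom n k *_) (sym (m≤n⇒m∸n≡0 (<⇒≤ n<k))) ⟩
      binom n k * (n ∸ k)     ∎
  where
  open ≡-Reasoning
  n<k = ≰⇒> k≰n

binom-suc≤binom : ∀ n k → n ∸ k ≤ suc k → binom n (suc k) ≤ binom n k
binom-suc≤binom n k n∸k≤1+k = *-cancelʳ-≤ (binom n (suc k)) (binom n k) (suc k)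
  (≤-trans (≤-reflexive (binom-suc-ratio n k)) (*-monoʳ-≤ (binom n k) n∸k≤1+k))

binom[a+b,2] : ∀ a b → binom (a + b) 2 ≡ a * b + (binom a 2 + binom b 2)
binom[a+b,2] zero    b = refl
binom[a+b,2] (suc a) b = begin
    binom (suc (a + b)) 2                      ≡⟨ binom[1+n,2] (a + b) ⟩
    (a + b) + binom (a + b) 2                  ≡⟨ cong ((a + b) +_) (binom[a+b,2] a b) ⟩
    (a + b) + (a * b + (binom a 2 + binom b 2)) ≡⟨ rearrange a b (a * b) (binom a 2) (binom b 2) ⟩
    suc a * b + ((a + binom a 2) + binom b 2)  ≡⟨ cong (λ x → suc a * b + (x + binom b 2)) (sym (binom[1+n,2] a)) ⟩
    suc a * b + (binom (suc a) 2 + binom b 2)  ∎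
  where
  open ≡-Reasoning
  rearrange : ∀ a b p A B → (a + b) + (p + (A + B)) ≡ (b + p) + ((a + A) + B)
  rearrange = solve-∀

2*binom[h,2]+h≡h*h : ∀ h → 2 * binom h 2 + h ≡ h * h
2*binom[h,2]+h≡h*h zero    = refl
2*binom[h,2]+h≡h*h (suc h) = begin
    2 * binom (suc h) 2 + suc h   ≡⟨ cong (λ x → 2 * x + suc h) (binom[1+n,2] h) ⟩
    2 * (h + binom h 2) + suc h   ≡⟨ rearrange h (binom h 2) ⟩
    (2 * binom h 2 + h) + (2 * h + 1) ≡⟨ cong (_+ (2 * h + 1)) (2*binom[h,2]+h≡h*h h) ⟩
    h * h + (2 * h + 1)           ≡⟨ square h ⟩
    suc h * suc h                 ∎
  where
  open ≡-Reasoning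
  rearrange : ∀ h B → 2 * (h + B) + suc h ≡ (2 * B + h) + (2 * h + 1)
  rearrange = solve-∀
  square : ∀ h → h * h + (2 * h + 1) ≡ suc h * suc h
  square = solve-∀

2*binom[h,2]≤h*h : ∀ h → binom h 2 + binom h 2 ≤ h * h
2*binom[h,2]≤h*h h = begin
    binom h 2 + binom h 2      ≡⟨ cong (binom h 2 +_) (sym (+-identityʳ (binom h 2))) ⟩
    2 * binom h 2              ≤⟨ m≤m+n (2 * binom h 2) h ⟩
    2 * binom h 2 + h          ≡⟨ 2*binom[h,2]+h≡h*h h ⟩
    h * h                      ∎
  where open ≤-Reasoning

private
  variable
    A B : Set

sum-map-++ : (h : A → ℕ) (xs ys : List A) → sum (map h (xs ++ ys)) ≡ sum (map h xs) + sum (map h ys)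
sum-map-++ h xs ys = trans (cong sum (map-++ h xs ys)) (sum-++ (map h xs) (map h ys))

sum-map-cong : ∀ {f g : A → ℕ} (L : List A) → (∀ x → f x ≡ g x) → sum (map f L) ≡ sum (map g L)
sum-map-cong []      _ = refl
sum-map-cong (x ∷ L) e = cong₂ _+_ (e x) (sum-map-cong L e)

sum-map-mono : ∀ {f g : A → ℕ} (L : List A) → (∀ x → f x ≤ g x) → sum (map f L) ≤ sum (map g L)
sum-map-mono []      _ = z≤n
sum-map-mono (x ∷ L) e = +-mono-≤ (e x) (sum-map-mono L e)

sum-map-+ : (f g : A → ℕ) (L : List A) → sum (map (λ x → f x + g x) L) ≡ sum (map f L) + sum (map g L)
sum-map-+ f g []      = refl
sum-map-+ f g (x ∷ L) =
  trans (cong (f x + g x +_) (sum-map-+ f g L)) (+-+-comm (f x) (g x) (sum (map f L)) (sum (map g L)))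
  where
  +-+-comm : ∀ a b c d → a + b + (c + d) ≡ a + c + (b + d)
  +-+-comm = solve-∀

sum-map-0 : (L : List A) → sum (map (λ _ → 0) L) ≡ 0
sum-map-0 []      = refl
sum-map-0 (_ ∷ L) = sum-map-0 L

sum-map-concatMap : (h : B → ℕ) (f : A → List B) (xs : List A) →
  sum (map h (concatMap f xs)) ≡ sum (map (λ x → sum (map h (f x))) xs)
sum-map-concatMap h f []       = refl
sum-map-concatMap h f (x ∷ xs) =
  trans (sum-map-++ h (f x) (concatMap f xs)) (cong (sum (map h (f x)) +_) (sum-map-concatMap h f xs))

sum-map-concatMap-pair : (h : B → ℕ) (x y : A → B) (L : List A) →
  sum (map h (concatMap (λ l → x l ∷ y l ∷ []) L)) ≡ sum (map (λ l → h (x l) + h (y l)) L)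
sum-map-concatMap-pair h x y L =
  trans (sum-map-concatMap h _ L) (sum-map-cong L (λ l → cong (h (x l) +_) (+-identityʳ (h (y l)))))

sumFin : (n : ℕ) → (Fin n → ℕ) → ℕ
sumFin zero    f = 0
sumFin (suc n) f = f fzero + sumFin n (f ∘ fsuc)

sumFin-cong : ∀ n {f g : Fin n → ℕ} → (∀ i → f i ≡ g i) → sumFin n f ≡ sumFin n g
sumFin-cong zero    e = refl
sumFin-cong (suc n) e = cong₂ _+_ (e fzero) (sumFin-cong n (e ∘ fsuc))

sum-map-tabulate : ∀ n (g : A → ℕ) (f : Fin n → A) → sum (map g (tabulate f)) ≡ sumFin n (g ∘ f)
sum-map-tabulate zero    g f = refl
sum-map-tabulate (suc n) g f = cong (g (f fzero) +_) (sum-map-tabulate n g (f ∘ fsuc))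

sumFrom : (ℕ → ℕ) → ℕ → ℕ → ℕ
sumFrom f lo zero    = 0
sumFrom f lo (suc L) = f lo + sumFrom f (suc lo) L

sumFrom-snoc : ∀ f lo L → sumFrom f lo (suc L) ≡ sumFrom f lo L + f (lo + L)
sumFrom-snoc f lo zero    = trans (+-identityʳ (f lo)) (cong f (sym (+-identityʳ lo)))
sumFrom-snoc f lo (suc L) = begin
    f lo + sumFrom f (suc lo) (suc L)           ≡⟨ cong (f lo +_) (sumFrom-snoc f (suc lo) L) ⟩
    f lo + (sumFrom f (suc lo) L + f (suc lo + L)) ≡⟨ sym (+-assoc (f lo) _ _) ⟩
    f lo + sumFrom f (suc lo) L + f (suc lo + L)   ≡⟨ cong (λ x → f lo + sumFrom f (suc lo) L + f x) (sym (+-suc lo L)) ⟩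
    f lo + sumFrom f (suc lo) L + f (lo + suc L)   ∎
  where open ≡-Reasoning

sumFrom-suc : ∀ f lo L → sumFrom f (suc lo) L ≡ sumFrom (f ∘ suc) lo L
sumFrom-suc f lo zero    = refl
sumFrom-suc f lo (suc L) = cong (f (suc lo) +_) (sumFrom-suc f (suc lo) L)

sumFrom-cong : ∀ {f g} lo L → (∀ i → i < L → f (lo + i) ≡ g (lo + i)) → sumFrom f lo L ≡ sumFrom g lo L
sumFrom-cong lo zero e = refl
sumFrom-cong {f} {g} lo (suc L) e = cong₂ _+_
  (trans (cong f (sym (+-identityʳ lo))) (trans (e 0 (s≤s z≤n)) (cong g (+-identityʳ lo))))
  (sumFrom-cong {f} {g} (suc lo) L
    (λ i i<L → trans (cong f (sym (+-suc lo i))) (trans (e (suc i) (s≤s i<L)) (cong g (+-suc lo i)))))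

sumFrom-mono : ∀ {f g} lo L → (∀ i → i < L → f (lo + i) ≤ g (lo + i)) → sumFrom f lo L ≤ sumFrom g lo L
sumFrom-mono lo zero e = z≤n
sumFrom-mono {f} {g} lo (suc L) e = +-mono-≤
  (subst₂ _≤_ (cong f (+-identityʳ lo)) (cong g (+-identityʳ lo)) (e 0 (s≤s z≤n)))
  (sumFrom-mono {f} {g} (suc lo) L
    (λ i i<L → subst₂ _≤_ (cong f (+-suc lo i)) (cong g (+-suc lo i)) (e (suc i) (s≤s i<L))))

sumFrom-+ : ∀ f g lo L → sumFrom (λ a → f a + g a) lo L ≡ sumFrom f lo L + sumFrom g lo L
sumFrom-+ f g lo zero    = refl
sumFrom-+ f g lo (suc L) =
  trans (cong (f lo + g lo +_) (sumFrom-+ f g (suc lo) L)) (+-+-comm (f lo) (g lo) _ _)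
  where
  +-+-comm : ∀ a b c d → a + b + (c + d) ≡ a + c + (b + d)
  +-+-comm = solve-∀

term≤sumFrom : ∀ f lo L i → i < L → f (lo + i) ≤ sumFrom f lo L
term≤sumFrom f lo (suc L) zero    _         =
  subst (λ x → f x ≤ f lo + sumFrom f (suc lo) L) (sym (+-identityʳ lo)) (m≤m+n _ _)
term≤sumFrom f lo (suc L) (suc i) (s≤s i<L) =
  subst (λ x → f x ≤ f lo + sumFrom f (suc lo) L) (sym (+-suc lo i))
    (≤-trans (term≤sumFrom f (suc lo) L i i<L) (m≤n+m _ _))

-- Graphs covering a fixed bipartition

atPred : (ℕ → ℕ) → ℕ → ℕ
atPred f zero    = 0
atPred f (suc m) = f m

atPred-cong : ∀ {f g : ℕ → ℕ} → (∀ m → f m ≡ g m) → ∀ m → atPred f m ≡ atPred g m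
atPred-cong e zero    = refl
atPred-cong e (suc m) = e m

-- The number of m-subsets of a set of c free and i forced elements that
-- contain every forced element.
forcedSubsets : ℕ → ℕ → ℕ → ℕ
forcedSubsets c zero    m       = binom c m
forcedSubsets c (suc i) zero    = 0
forcedSubsets c (suc i) (suc m) = forcedSubsets c i m

forcedSubsets-suc-forced : ∀ c i m → forcedSubsets c (suc i) m ≡ atPred (forcedSubsets c i) m
forcedSubsets-suc-forced c i zero    = refl
forcedSubsets-suc-forced c i (suc m) = refl

forcedSubsets-suc-free : ∀ c i m → forcedSubsets (suc c) i m ≡ atPred (forcedSubsets c i) m + forcedSubsets c i m
forcedSubsets-suc-free c zero    zero    = refl
forcedSubsets-suc-free c zero    (suc m) = refl
forcedSubsets-suc-free c (suc i) zero    = refl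
forcedSubsets-suc-free c (suc i) (suc m) =
  trans (forcedSubsets-suc-free c i m) (cong (_+ forcedSubsets c i m) (sym (forcedSubsets-suc-forced c i m)))

forcedSubsets≡binom : ∀ c i m → forcedSubsets c i m ≡ (if m <ᵇ i then 0 else binom c (m ∸ i))
forcedSubsets≡binom c zero    m       = refl
forcedSubsets≡binom c (suc i) zero    = refl
forcedSubsets≡binom c (suc i) (suc m) = forcedSubsets≡binom c i m

isCross : Bool → Bool → ℕ
isCross b c = if sameSide b c then 0 else 1

isInner : Bool → Bool → ℕ
isInner b c = if sameSide b c then 1 else 0

module _ {n : ℕ} (side : Fin n → Bool) where

  crossPairCount : List (Fin n × Fin n) → ℕ
  crossPairCount ps = sum (map (λ p → isCross (side (proj₁ p)) (side (proj₂ p))) ps)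

  innerPairCount : List (Fin n × Fin n) → ℕ
  innerPairCount ps = sum (map (λ p → isInner (side (proj₁ p)) (side (proj₂ p))) ps)

  coveringGraphs : List (Fin n × Fin n) → ℕ → ℕ
  coveringGraphs ps m =
    sum (map (λ g → indicator (coverOK side ps g ∧ (countTrue g ≡ᵇ m))) (allBools (length ps)))

  coveringGraphs-cons : ∀ i j ps m → coveringGraphs ((i , j) ∷ ps) m ≡
    (if sameSide (side i) (side j)
       then atPred (coveringGraphs ps) m
       else atPred (coveringGraphs ps) m + coveringGraphs ps m)
  coveringGraphs-cons i j ps m =
    trans (sum-map-concatMap-pair _ (true ∷_) (false ∷_) (allBools (length ps)))
          (split (sameSide (side i) (side j)) m)
    where
    L = allBools (length ps)
    split : ∀ s m →
      sum (map (λ l → indicator (((not s ∨ true) ∧ coverOK side ps l) ∧ (suc (countTrue l) ≡ᵇ m))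
                    + indicator (((not s ∨ false) ∧ coverOK side ps l) ∧ (countTrue l ≡ᵇ m))) L)
      ≡ (if s then atPred (coveringGraphs ps) m else atPred (coveringGraphs ps) m + coveringGraphs ps m)
    split true  zero    = trans (sum-map-cong L (λ l → cong (λ t → indicator t + 0) (∧-zeroʳ (coverOK side ps l))))
                                (sum-map-0 L)
    split true  (suc m) = sum-map-cong L (λ l → +-identityʳ _)
    split false zero    = trans (sum-map-+ _ _ L)
      (cong (_+ coveringGraphs ps zero)
        (trans (sum-map-cong L (λ l → cong indicator (∧-zeroʳ (coverOK side ps l)))) (sum-map-0 L)))
    split false (suc m) = sum-map-+ _ _ L

  coveringGraphs≡forcedSubsets : ∀ ps m →
    coveringGraphs ps m ≡ forcedSubsets (crossPairCount ps) (innerPairCount ps) m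
  coveringGraphs≡forcedSubsets []             zero    = refl
  coveringGraphs≡forcedSubsets []             (suc m) = refl
  coveringGraphs≡forcedSubsets ((i , j) ∷ ps) m       =
    trans (coveringGraphs-cons i j ps m) (byPairType (sameSide (side i) (side j)))
    where
    IH = coveringGraphs≡forcedSubsets ps
    byPairType : (s : Bool) →
      (if s then atPred (coveringGraphs ps) m else atPred (coveringGraphs ps) m + coveringGraphs ps m)
      ≡ forcedSubsets ((if s then 0 else 1) + crossPairCount ps) ((if s then 1 else 0) + innerPairCount ps) m
    byPairType true  = trans (atPred-cong IH m) (sym (forcedSubsets-suc-forced (crossPairCount ps) (innerPairCount ps) m))
    byPairType false = trans (cong₂ _+_ (atPred-cong IH m) (IH m)) (sym (forcedSubsets-suc-free (crossPairCount ps) (innerPairCount ps) m))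

sumOrderedPairs : (n : ℕ) → (Fin n → Fin n → ℕ) → ℕ
sumOrderedPairs n h = sumFin n (λ i → sumFin n (λ j → if toℕ i <ᵇ toℕ j then h i j else 0))

sum-map-pairs : ∀ n (g : Fin n × Fin n → ℕ) → sum (map g (pairs n)) ≡ sumOrderedPairs n (λ i j → g (i , j))
sum-map-pairs n g =
  trans (sum-map-concatMap g _ (allFin n))
  (trans (sum-map-tabulate n _ id)
  (sumFin-cong n (λ i → trans (sum-map-concatMap g _ (allFin n))
     (trans (sum-map-tabulate n _ id) (sumFin-cong n (λ j → sum-singleton-if (toℕ i <ᵇ toℕ j) (i , j)))))))
  where
  sum-singleton-if : ∀ b p → sum (map g (if b then [ p ] else [])) ≡ (if b then g p else 0)
  sum-singleton-if true  p = +-identityʳ (g p)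
  sum-singleton-if false p = refl

countFalseV : ∀ {k} → Vec Bool k → ℕ
countFalseV []v           = 0
countFalseV (true  ∷v bs) = countFalseV bs
countFalseV (false ∷v bs) = suc (countFalseV bs)

countTrueV+countFalseV≡k : ∀ {k} (s : Vec Bool k) → countTrueV s + countFalseV s ≡ k
countTrueV+countFalseV≡k []v          = refl
countTrueV+countFalseV≡k (true  ∷v s) = cong suc (countTrueV+countFalseV≡k s)
countTrueV+countFalseV≡k (false ∷v s) = trans (+-suc _ _) (cong suc (countTrueV+countFalseV≡k s))

countFalseV≡k∸countTrueV : ∀ {k} (s : Vec Bool k) → countFalseV s ≡ k ∸ countTrueV s
countFalseV≡k∸countTrueV {k} s =
  trans (sym (m+n∸m≡n (countTrueV s) (countFalseV s))) (cong (_∸ countTrueV s) (countTrueV+countFalseV≡k s))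

sumFin-isCross-true : ∀ {n} (s : Vec Bool n) → sumFin n (λ j → isCross true (lookup s j)) ≡ countFalseV s
sumFin-isCross-true []v          = refl
sumFin-isCross-true (true  ∷v s) = sumFin-isCross-true s
sumFin-isCross-true (false ∷v s) = cong suc (sumFin-isCross-true s)

sumFin-isCross-false : ∀ {n} (s : Vec Bool n) → sumFin n (λ j → isCross false (lookup s j)) ≡ countTrueV s
sumFin-isCross-false []v          = refl
sumFin-isCross-false (true  ∷v s) = cong suc (sumFin-isCross-false s)
sumFin-isCross-false (false ∷v s) = sumFin-isCross-false s

sumFin-isInner-true : ∀ {n} (s : Vec Bool n) → sumFin n (λ j → isInner true (lookup s j)) ≡ countTrueV s
sumFin-isInner-true []v          = refl
sumFin-isInner-true (true  ∷v s) = cong suc (sumFin-isInner-true s)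
sumFin-isInner-true (false ∷v s) = sumFin-isInner-true s

sumFin-isInner-false : ∀ {n} (s : Vec Bool n) → sumFin n (λ j → isInner false (lookup s j)) ≡ countFalseV s
sumFin-isInner-false []v          = refl
sumFin-isInner-false (true  ∷v s) = sumFin-isInner-false s
sumFin-isInner-false (false ∷v s) = cong suc (sumFin-isInner-false s)

crossPairs-count : ∀ {n} (s : Vec Bool n) →
  sumOrderedPairs n (λ i j → isCross (lookup s i) (lookup s j)) ≡ countTrueV s * countFalseV s
crossPairs-count []v          = refl
crossPairs-count (true  ∷v s) = cong₂ _+_ (sumFin-isCross-true s) (crossPairs-count s)
crossPairs-count (false ∷v s) =
  trans (cong₂ _+_ (sumFin-isCross-false s) (crossPairs-count s)) (sym (*-suc (countTrueV s) (countFalseV s)))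

innerPairs-count : ∀ {n} (s : Vec Bool n) →
  sumOrderedPairs n (λ i j → isInner (lookup s i) (lookup s j)) ≡ binom (countTrueV s) 2 + binom (countFalseV s) 2
innerPairs-count []v          = refl
innerPairs-count (true  ∷v s) = trans (cong₂ _+_ (sumFin-isInner-true s) (innerPairs-count s)) (begin
    t + (binom t 2 + binom f 2)  ≡⟨ sym (+-assoc t _ _) ⟩
    t + binom t 2 + binom f 2    ≡⟨ cong (_+ binom f 2) (sym (binom[1+n,2] t)) ⟩
    binom (suc t) 2 + binom f 2  ∎)
  where
  open ≡-Reasoning
  t = countTrueV s
  f = countFalseV s
innerPairs-count (false ∷v s) = trans (cong₂ _+_ (sumFin-isInner-false s) (innerPairs-count s)) (begin
    f + (binom t 2 + binom f 2)  ≡⟨ +-left-comm f (binom t 2) (binom f 2) ⟩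
    binom t 2 + (f + binom f 2)  ≡⟨ cong (binom t 2 +_) (sym (binom[1+n,2] f)) ⟩
    binom t 2 + binom (suc f) 2  ∎)
  where
  open ≡-Reasoning
  t = countTrueV s
  f = countFalseV s
  +-left-comm : ∀ x y z → x + (y + z) ≡ y + (x + z)
  +-left-comm = solve-∀

-- The number of graphs with m edges covering a bipartition into parts of sizes a and b.
covers : ℕ → ℕ → ℕ → ℕ
covers a b m = if m <ᵇ (binom a 2 + binom b 2) then 0 else binom (a * b) (m ∸ (binom a 2 + binom b 2))

crossTerm≡covers : ∀ a b m → crossTerm a b m ≡ covers a b m
crossTerm≡covers a b m rewrite C≡binom a 2 | C≡binom b 2 =
  cong (λ x → if m <ᵇ (binom a 2 + binom b 2) then 0 else x) (C≡binom (a * b) (m ∸ (binom a 2 + binom b 2)))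

coveringGraphs-pairs : ∀ n (s : Vec Bool n) m →
  coveringGraphs (lookup s) (pairs n) m ≡ covers (countTrueV s) (n ∸ countTrueV s) m
coveringGraphs-pairs n s m = begin
    coveringGraphs (lookup s) (pairs n) m
      ≡⟨ coveringGraphs≡forcedSubsets (lookup s) (pairs n) m ⟩
    forcedSubsets (crossPairCount (lookup s) (pairs n)) (innerPairCount (lookup s) (pairs n)) m
      ≡⟨ cong₂ (λ x y → forcedSubsets x y m)
           (trans (sum-map-pairs n _) (crossPairs-count s)) (trans (sum-map-pairs n _) (innerPairs-count s)) ⟩
    forcedSubsets (t * f) (binom t 2 + binom f 2) m
      ≡⟨ forcedSubsets≡binom (t * f) (binom t 2 + binom f 2) m ⟩
    covers t f m
      ≡⟨ cong (λ z → covers t z m) (countFalseV≡k∸countTrueV s) ⟩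
    covers t (n ∸ t) m ∎
  where
  open ≡-Reasoning
  t = countTrueV s
  f = countFalseV s

coversOfSize : ℕ → ℕ → ℕ → ℕ
coversOfSize n m a = covers a (n ∸ a) m

covCount≡ : ∀ n m →
  covCount n m ≡ sum (map (λ s → if canonical s then coversOfSize n m (countTrueV s) else 0) (allSides n))
covCount≡ n m = sum-map-cong (allSides n) (λ s → byCanonical s (canonical s))
  where
  byCanonical : (s : Vec Bool n) (b : Bool) →
    sum (map (λ g → indicator (b ∧ (coverOK (lookup s) (pairs n) g ∧ (countTrue g ≡ᵇ m))))
             (allBools (length (pairs n))))
    ≡ (if b then coversOfSize n m (countTrueV s) else 0)
  byCanonical s true  = coveringGraphs-pairs n s m
  byCanonical s false = sum-map-0 (allBools (length (pairs n)))

-- Sums over bipartitions grouped by part size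

binomSum-pascal : ∀ n (f : ℕ → ℕ) →
  sumFrom (λ a → binom n a * f (suc a)) 0 (suc n) + sumFrom (λ a → binom n a * f a) 0 (suc n)
  ≡ sumFrom (λ a → binom (suc n) a * f a) 0 (suc (suc n))
binomSum-pascal n f = begin
    X + (f₀ + sumFrom g 1 n)
      ≡⟨ cong (λ x → X + (f₀ + x)) (sumFrom-suc g 0 n) ⟩
    X + (f₀ + sumFrom (g ∘ suc) 0 n)
      ≡⟨ cong (λ x → X + (f₀ + x)) (sym (trans (sumFrom-snoc (g ∘ suc) 0 n)
           (trans (cong (sumFrom (g ∘ suc) 0 n +_) (cong (_* f (suc n)) (n<k⇒binom≡0 n (suc n) ≤-refl)))
                  (+-identityʳ _)))) ⟩
    X + (f₀ + Y)
      ≡⟨ +-left-comm X f₀ Y ⟩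
    f₀ + (X + Y)
      ≡⟨ cong (f₀ +_) (sym (sumFrom-+ (λ a → binom n a * f (suc a)) (g ∘ suc) 0 (suc n))) ⟩
    f₀ + sumFrom (λ a → binom n a * f (suc a) + binom n (suc a) * f (suc a)) 0 (suc n)
      ≡⟨ cong (f₀ +_) (sumFrom-cong 0 (suc n) (λ i _ → sym (*-distribʳ-+ (f (suc i)) (binom n i) (binom n (suc i))))) ⟩
    f₀ + sumFrom (λ a → binom (suc n) (suc a) * f (suc a)) 0 (suc n)
      ≡⟨ cong (f₀ +_) (sym (sumFrom-suc (λ a → binom (suc n) a * f a) 0 (suc n))) ⟩
    sumFrom (λ a → binom (suc n) a * f a) 0 (suc (suc n)) ∎
  where
  open ≡-Reasoning
  g = λ a → binom n a * f a
  f₀ = g 0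
  X = sumFrom (λ a → binom n a * f (suc a)) 0 (suc n)
  Y = sumFrom (g ∘ suc) 0 (suc n)
  +-left-comm : ∀ x y z → x + (y + z) ≡ y + (x + z)
  +-left-comm = solve-∀

-- Any vector statistic that counts one of the two letters groups the 2^n
-- vectors by value with multiplicities C(n,a).
sum-allSides-by : (stat : ∀ {k} → Vec Bool k → ℕ) → stat []v ≡ 0 →
  (∀ {k} (v : Vec Bool k) (f : ℕ → ℕ) → f (stat (true ∷v v)) + f (stat (false ∷v v)) ≡ f (suc (stat v)) + f (stat v)) →
  ∀ n (f : ℕ → ℕ) → sum (map (λ s → f (stat s)) (allSides n)) ≡ sumFrom (λ a → binom n a * f a) 0 (suc n)
sum-allSides-by stat stat[]≡0 stat-cons zero    f =
  trans (cong (λ x → f x + 0) stat[]≡0) (cong (_+ 0) (sym (+-identityʳ (f 0))))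
sum-allSides-by stat stat[]≡0 stat-cons (suc n) f = begin
    sum (map (λ s → f (stat s)) (allSides (suc n)))
      ≡⟨ sum-map-concatMap-pair (λ s → f (stat s)) (true ∷v_) (false ∷v_) (allSides n) ⟩
    sum (map (λ v → f (stat (true ∷v v)) + f (stat (false ∷v v))) (allSides n))
      ≡⟨ sum-map-cong (allSides n) (λ v → stat-cons v f) ⟩
    sum (map (λ v → f (suc (stat v)) + f (stat v)) (allSides n))
      ≡⟨ sum-map-+ _ _ (allSides n) ⟩
    sum (map (λ v → f (suc (stat v))) (allSides n)) + sum (map (λ v → f (stat v)) (allSides n))
      ≡⟨ cong₂ _+_ (sum-allSides-by stat stat[]≡0 stat-cons n (f ∘ suc)) (sum-allSides-by stat stat[]≡0 stat-cons n f) ⟩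
    sumFrom (λ a → binom n a * f (suc a)) 0 (suc n) + sumFrom (λ a → binom n a * f a) 0 (suc n)
      ≡⟨ binomSum-pascal n f ⟩
    sumFrom (λ a → binom (suc n) a * f a) 0 (suc (suc n)) ∎
  where open ≡-Reasoning

sum-allSides-countTrueV : ∀ n (f : ℕ → ℕ) →
  sum (map (λ s → f (countTrueV s)) (allSides n)) ≡ sumFrom (λ a → binom n a * f a) 0 (suc n)
sum-allSides-countTrueV = sum-allSides-by countTrueV refl (λ v f → refl)

sum-allSides-countFalseV : ∀ n (f : ℕ → ℕ) →
  sum (map (λ s → f (countFalseV s)) (allSides n)) ≡ sumFrom (λ a → binom n a * f a) 0 (suc n)
sum-allSides-countFalseV = sum-allSides-by countFalseV refl (λ v f → +-comm (f (countFalseV v)) (f (suc (countFalseV v))))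

binomSum-complement : ∀ n (f : ℕ → ℕ) →
  sumFrom (λ a → binom n a * f (n ∸ a)) 0 (suc n) ≡ sumFrom (λ a → binom n a * f a) 0 (suc n)
binomSum-complement n f = begin
    sumFrom (λ a → binom n a * f (n ∸ a)) 0 (suc n)  ≡⟨ sym (sum-allSides-countTrueV n (λ a → f (n ∸ a))) ⟩
    sum (map (λ s → f (n ∸ countTrueV s)) (allSides n)) ≡⟨ sum-map-cong (allSides n) (λ s → cong f (sym (countFalseV≡k∸countTrueV s))) ⟩
    sum (map (λ s → f (countFalseV s)) (allSides n))    ≡⟨ sum-allSides-countFalseV n f ⟩
    sumFrom (λ a → binom n a * f a) 0 (suc n)         ∎
  where open ≡-Reasoning

-- Moving a vertex to the larger part

¬T⇒≡false : ∀ {b} → ¬ T b → b ≡ false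
¬T⇒≡false {true}  ¬t = ⊥-elim (¬t tt)
¬T⇒≡false {false} _  = refl

covers-below : ∀ a b m → m < binom a 2 + binom b 2 → covers a b m ≡ 0
covers-below a b m m<I rewrite Equivalence.to T-≡ (<⇒<ᵇ m<I) = refl

covers-above : ∀ a b m → binom a 2 + binom b 2 ≤ m → covers a b m ≡ binom (a * b) (m ∸ (binom a 2 + binom b 2))
covers-above a b m I≤m rewrite ¬T⇒≡false (λ t → <⇒≱ (<ᵇ⇒< m (binom a 2 + binom b 2) t) I≤m) = refl

covers-comm : ∀ a b m → covers a b m ≡ covers b a m
covers-comm a b m rewrite +-comm (binom a 2) (binom b 2) | *-comm a b = refl

-- C(X,Y)·Y = C(X−1,Y−1)·X ≥ C(x,y)·X, for X = x+e+1 and Y = y+e+1.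
binom-ratio-shift : ∀ x y e j → suc (e + y) * suc j ≤ suc (e + x) * j →
  binom x y * suc j ≤ binom (suc (e + x)) (suc (e + y)) * j
binom-ratio-shift x y e j hyp = *-cancelʳ-≤ (binom x y * suc j) (CXY * j) X (begin
    binom x y * suc j * X  ≡⟨ *-right-comm (binom x y) (suc j) X ⟩
    binom x y * X * suc j  ≤⟨ *-monoˡ-≤ (suc j) absorbed ⟩
    CXY * Y * suc j          ≡⟨ *-assoc CXY Y (suc j) ⟩
    CXY * (Y * suc j)        ≤⟨ *-monoʳ-≤ CXY hyp ⟩
    CXY * (X * j)            ≡⟨ trans (sym (*-assoc CXY X j)) (*-right-comm CXY X j) ⟩
    CXY * j * X              ∎)
  where
  open ≤-Reasoning
  X = suc (e + x)
  Y = suc (e + y)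
  CXY = binom X Y
  absorbed : binom x y * X ≤ CXY * Y
  absorbed = ≤-trans (*-monoˡ-≤ X (binom-mono-+ e x y)) (≤-reflexive (sym (binom-absorption (e + x) (e + y))))
  *-right-comm : ∀ p q r → p * q * r ≡ p * r * q
  *-right-comm = solve-∀

-- Moving a vertex from a part of size b+1 to a part of size a ≥ b+1 adds
-- a − b = e + 1 inner pairs.
innerPairs-move : ∀ b e →
  binom (suc (suc (b + e))) 2 + binom b 2 ≡ binom (suc (b + e)) 2 + binom (suc b) 2 + suc e
innerPairs-move b e = begin
    binom (suc a) 2 + binom b 2               ≡⟨ cong (_+ binom b 2) (binom[1+n,2] a) ⟩
    a + binom a 2 + binom b 2                 ≡⟨ rearrange b e (binom a 2) (binom b 2) ⟩
    binom a 2 + (b + binom b 2) + suc e       ≡⟨ cong (λ z → binom a 2 + z + suc e) (sym (binom[1+n,2] b)) ⟩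
    binom a 2 + binom (suc b) 2 + suc e       ∎
  where
  open ≡-Reasoning
  a = suc (b + e)
  rearrange : ∀ b e A B → suc (b + e) + A + B ≡ A + (b + B) + suc e
  rearrange = solve-∀

covers-ratio : ∀ b e m j → suc j * m ≤ binom (suc (b + e) + suc b) 2 * j →
  covers (suc (suc (b + e))) b m * suc j ≤ covers (suc (b + e)) (suc b) m * j
covers-ratio b e m j hyp with m <? binom (suc (suc (b + e))) 2 + binom b 2
... | yes m<I' = ≤-trans (≤-reflexive (cong (_* suc j) (covers-below (suc (suc (b + e))) b m m<I'))) z≤n
... | no m≮I' = subst₂ (λ u v → u * suc j ≤ v * j)
        (sym (covers-above (suc a) b m I'≤m)) (sym (covers-above a (suc b) m I≤m))
        (subst₂ (λ u v → binom x y * suc j ≤ binom u v * j) (sym cross≡) (sym m∸I≡)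
          (binom-ratio-shift x y e j (subst₂ (λ u v → u * suc j ≤ v * j) m∸I≡ cross≡ free≤)))
  where
  a = suc (b + e)
  I = binom a 2 + binom (suc b) 2
  I' = binom (suc a) 2 + binom b 2
  I'≤m : I' ≤ m
  I'≤m = ≮⇒≥ m≮I'
  I≤m : I ≤ m
  I≤m = ≤-trans (≤-trans (m≤m+n I (suc e)) (≤-reflexive (sym (innerPairs-move b e)))) I'≤m
  x = suc a * b
  y = m ∸ I'
  cross≡ : a * suc b ≡ suc (e + x)
  cross≡ = expand b e
    where
    expand : ∀ b e → suc (b + e) * suc b ≡ suc (e + suc (suc (b + e)) * b)
    expand = solve-∀
  m∸I≡ : m ∸ I ≡ suc (e + y)
  m∸I≡ = begin
      m ∸ I                  ≡⟨ cong (_∸ I) (sym (m∸n+n≡m I'≤m)) ⟩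
      (y + I') ∸ I           ≡⟨ cong (λ z → (y + z) ∸ I) (innerPairs-move b e) ⟩
      (y + (I + suc e)) ∸ I  ≡⟨ cong (_∸ I) (rearrange y I (suc e)) ⟩
      (y + suc e + I) ∸ I    ≡⟨ m+n∸n≡m (y + suc e) I ⟩
      y + suc e              ≡⟨ +-comm y (suc e) ⟩
      suc (e + y)            ∎
    where
    open ≡-Reasoning
    rearrange : ∀ p q r → p + (q + r) ≡ p + r + q
    rearrange = solve-∀
  -- m ≤ (j/(j+1))·C(n,2) gives the same bound for the m − I free edges among the a(b+1) cross pairs
  free≤ : (m ∸ I) * suc j ≤ (a * suc b) * j
  free≤ = +-cancelʳ-≤ (I * suc j) _ _ (begin
      (m ∸ I) * suc j + I * suc j   ≡⟨ sym (*-distribʳ-+ (suc j) (m ∸ I) I) ⟩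
      (m ∸ I + I) * suc j           ≡⟨ cong (_* suc j) (m∸n+n≡m I≤m) ⟩
      m * suc j                     ≡⟨ *-comm m (suc j) ⟩
      suc j * m                     ≤⟨ hyp ⟩
      binom (a + suc b) 2 * j       ≡⟨ cong (_* j) (binom[a+b,2] a (suc b)) ⟩
      (a * suc b + I) * j           ≡⟨ *-distribʳ-+ j (a * suc b) I ⟩
      a * suc b * j + I * j         ≤⟨ +-monoʳ-≤ (a * suc b * j) (*-monoʳ-≤ I (n≤1+n j)) ⟩
      a * suc b * j + I * suc j     ∎)
    where open ≤-Reasoning

weight : ℕ → ℕ → ℕ → ℕ
weight n m a = binom n a * coversOfSize n m a

weight-ratio-unbalanced : ∀ b e m j → suc j * m ≤ binom (suc (b + e) + suc b) 2 * j →
  weight (suc (b + e) + suc b) m (suc (suc (b + e))) * suc j ≤ weight (suc (b + e) + suc b) m (suc (b + e)) * j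
weight-ratio-unbalanced b e m j hyp = begin
    binom n (suc a) * coversOfSize n m (suc a) * suc j     ≡⟨ *-assoc (binom n (suc a)) _ (suc j) ⟩
    binom n (suc a) * (coversOfSize n m (suc a) * suc j)   ≡⟨ cong (λ z → binom n (suc a) * (covers (suc a) z m * suc j)) n∸[1+a]≡b ⟩
    binom n (suc a) * (covers (suc a) b m * suc j)         ≤⟨ *-mono-≤ binom-decreasing (covers-ratio b e m j hyp) ⟩
    binom n a * (covers a (suc b) m * j)                   ≡⟨ cong (λ z → binom n a * (covers a z m * j)) (sym n∸a≡1+b) ⟩
    binom n a * (coversOfSize n m a * j)                   ≡⟨ sym (*-assoc (binom n a) _ j) ⟩
    binom n a * coversOfSize n m a * j                     ∎
  where
  open ≤-Reasoning
  a = suc (b + e)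
  n = a + suc b
  n∸[1+a]≡b : n ∸ suc a ≡ b
  n∸[1+a]≡b = trans (cong (_∸ suc a) (+-suc a b)) (m+n∸m≡n a b)
  n∸a≡1+b : n ∸ a ≡ suc b
  n∸a≡1+b = m+n∸m≡n a (suc b)
  binom-decreasing : binom n (suc a) ≤ binom n a
  binom-decreasing = binom-suc≤binom n a (subst (_≤ suc a) (sym n∸a≡1+b) (s≤s (≤-trans (m≤m+n b e) (n≤1+n _))))

weight-ratio : ∀ n m j a → suc j * m ≤ binom n 2 * j → n ≤ a + a →
  weight n m (suc a) * suc j ≤ weight n m a * j
weight-ratio n m j a hyp n≤2a with n ≤? a
... | yes n≤a = ≤-trans (≤-reflexive (cong (λ z → z * coversOfSize n m (suc a) * suc j) (n<k⇒binom≡0 n (suc a) (s≤s n≤a)))) z≤n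
... | no n≰a = at n a (a ∸ suc b) n≡a+1+b a≡1+b+e hyp
  where
  a<n : a < n
  a<n = ≰⇒> n≰a
  b = n ∸ suc a
  n≡a+1+b : n ≡ a + suc b
  n≡a+1+b = trans (sym (m+[n∸m]≡n a<n)) (sym (+-suc a b))
  1+b≤a : suc b ≤ a
  1+b≤a = +-cancelˡ-≤ a _ _ (subst (_≤ a + a) n≡a+1+b n≤2a)
  a≡1+b+e : a ≡ suc (b + (a ∸ suc b))
  a≡1+b+e = sym (m+[n∸m]≡n 1+b≤a)
  at : ∀ n′ a′ e → n′ ≡ a′ + suc b → a′ ≡ suc (b + e) → suc j * m ≤ binom n′ 2 * j →
       weight n′ m (suc a′) * suc j ≤ weight n′ m a′ * j
  at _ _ e refl refl = weight-ratio-unbalanced b e m j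

module _ (G : ℕ → ℕ) (P c : ℕ) (ratio : ∀ a → c ≤ a → G (suc a) * suc P ≤ G a * P) where

  geometric-decay : ∀ t → G (c + t) * suc P ^ t ≤ G c * P ^ t
  geometric-decay zero    = ≤-reflexive (cong (λ z → G z * 1) (+-identityʳ c))
  geometric-decay (suc t) = begin
      G (c + suc t) * (suc P * suc P ^ t)    ≡⟨ cong (λ z → G z * (suc P * suc P ^ t)) (+-suc c t) ⟩
      G (suc (c + t)) * (suc P * suc P ^ t)  ≡⟨ sym (*-assoc (G (suc (c + t))) (suc P) _) ⟩
      G (suc (c + t)) * suc P * suc P ^ t    ≤⟨ *-monoˡ-≤ (suc P ^ t) (ratio (c + t) (m≤m+n c t)) ⟩
      G (c + t) * P * suc P ^ t              ≡⟨ *-right-comm (G (c + t)) P (suc P ^ t) ⟩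
      G (c + t) * suc P ^ t * P              ≤⟨ *-monoˡ-≤ P (geometric-decay t) ⟩
      G c * P ^ t * P                        ≡⟨ trans (*-assoc (G c) (P ^ t) P) (cong (G c *_) (*-comm (P ^ t) P)) ⟩
      G c * (P * P ^ t)                      ∎
    where
    open ≤-Reasoning
    *-right-comm : ∀ x y z → x * y * z ≡ x * z * y
    *-right-comm = solve-∀

  geometric-tail : ∀ L a₀ → c ≤ a₀ → sumFrom G a₀ L ≤ G a₀ * suc P
  geometric-tail zero    a₀ c≤a₀ = z≤n
  geometric-tail (suc L) a₀ c≤a₀ = begin
      G a₀ + sumFrom G (suc a₀) L  ≤⟨ +-monoʳ-≤ (G a₀) (geometric-tail L (suc a₀) (m≤n⇒m≤1+n c≤a₀)) ⟩
      G a₀ + G (suc a₀) * suc P    ≤⟨ +-monoʳ-≤ (G a₀) (ratio a₀ c≤a₀) ⟩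
      G a₀ + G a₀ * P              ≡⟨ sym (*-suc (G a₀) P) ⟩
      G a₀ * suc P                 ∎
    where open ≤-Reasoning

bernoulli : ∀ P t → (P + t) * P ^ t ≤ suc P ^ t * P
bernoulli P zero    = ≤-reflexive (base P)
  where
  base : ∀ P → (P + 0) * 1 ≡ 1 * P
  base = solve-∀
bernoulli P (suc t) = begin
    (P + suc t) * (P * P ^ t)                  ≡⟨ expand P t (P ^ t) ⟩
    P * ((P + t) * P ^ t) + P * P ^ t          ≤⟨ +-monoʳ-≤ (P * ((P + t) * P ^ t)) (*-monoˡ-≤ (P ^ t) (m≤m+n P t)) ⟩
    P * ((P + t) * P ^ t) + (P + t) * P ^ t    ≡⟨ collect P ((P + t) * P ^ t) ⟩
    suc P * ((P + t) * P ^ t)                  ≤⟨ *-monoʳ-≤ (suc P) (bernoulli P t) ⟩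
    suc P * (suc P ^ t * P)                    ≡⟨ sym (*-assoc (suc P) (suc P ^ t) P) ⟩
    suc P * suc P ^ t * P                      ∎
  where
  open ≤-Reasoning
  expand : ∀ P t w → (P + suc t) * (P * w) ≡ P * ((P + t) * w) + P * w
  expand = solve-∀
  collect : ∀ P v → P * v + v ≡ suc P * v
  collect = solve-∀

X*P^t≤[1+P]^t : ∀ P X t → X * suc P ≤ t → X * P ^ t ≤ suc P ^ t
X*P^t≤[1+P]^t zero    zero    t       _  = z≤n
X*P^t≤[1+P]^t zero    (suc X) (suc t) _  = ≤-trans (≤-reflexive (*-zeroʳ (suc X))) z≤n
X*P^t≤[1+P]^t (suc p) X       t       le = *-cancelʳ-≤ (X * P ^ t) (suc P ^ t) P (begin
    X * P ^ t * P    ≡⟨ *-right-comm X (P ^ t) P ⟩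
    X * P * P ^ t    ≤⟨ *-monoˡ-≤ (P ^ t) (≤-trans (*-monoʳ-≤ X (n≤1+n P)) le) ⟩
    t * P ^ t        ≤⟨ *-monoˡ-≤ (P ^ t) (m≤n+m t P) ⟩
    (P + t) * P ^ t  ≤⟨ bernoulli P t ⟩
    suc P ^ t * P    ∎)
  where
  open ≤-Reasoning
  P = suc p
  *-right-comm : ∀ x y z → x * y * z ≡ x * z * y
  *-right-comm = solve-∀

if-T : ∀ {A : Set} {b} {x y : A} → T b → (if b then x else y) ≡ x
if-T {b = true} _ = refl

if-≤ : ∀ b x → (if b then x else 0) ≤ x
if-≤ true  x = ≤-refl
if-≤ false x = z≤n

sumFrom-restrict : ∀ (f : ℕ → ℕ) a₀ L lo → lo ≤ a₀ →
  sumFrom (λ a → if a₀ ≤ᵇ a then f a else 0) lo L ≤ sumFrom f a₀ L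
sumFrom-restrict f a₀ zero    lo lo≤a₀ = z≤n
sumFrom-restrict f a₀ (suc L) lo lo≤a₀ with m≤n⇒m<n∨m≡n lo≤a₀
... | inj₁ lo<a₀ = begin
    (if a₀ ≤ᵇ lo then f lo else 0) + rest
      ≡⟨ cong (_+ rest) (if-false (λ t → <⇒≱ lo<a₀ (≤ᵇ⇒≤ a₀ lo t))) ⟩
    rest
      ≤⟨ sumFrom-restrict f a₀ L (suc lo) lo<a₀ ⟩
    sumFrom f a₀ L
      ≤⟨ m≤m+n (sumFrom f a₀ L) (f (a₀ + L)) ⟩
    sumFrom f a₀ L + f (a₀ + L)
      ≡⟨ sym (sumFrom-snoc f a₀ L) ⟩
    sumFrom f a₀ (suc L) ∎
  where
  open ≤-Reasoning
  rest = sumFrom (λ a → if a₀ ≤ᵇ a then f a else 0) (suc lo) L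
  if-false : ∀ {b} → ¬ T b → (if b then f lo else 0) ≡ 0
  if-false ¬t rewrite ¬T⇒≡false ¬t = refl
... | inj₂ refl = sumFrom-mono lo (suc L) (λ i _ → if-≤ (lo ≤ᵇ (lo + i)) (f (lo + i)))

-- A uniform bound for the almost-equitable threshold

-- The slack 2·k^N makes the recursion for expScaled close up: once
-- N + 1 ≥ 2k it absorbs the new top term k^(N+1).
expScaled⁺ : ℕ → ℕ → ℕ
expScaled⁺ k N = expScaled k N + 2 * k ^ N

expScaled⁺-suc : ∀ k N → expScaled⁺ k (suc N) ≤ suc N * (3 * k + 1) * expScaled⁺ k N
expScaled⁺-suc k N = ≤-trans (m≤m+n _ _) (≤-reflexive (sym (expand N k (expScaled k N) (k ^ N))))
  where
  expand : ∀ N k E P → suc N * (3 * k + 1) * (E + 2 * P) ≡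
    (suc N * E + k * P + 2 * (k * P)) + (suc N * (3 * k) * E + (2 * N * (3 * k + 1) + 3 * k + 2) * P)
  expand = solve-∀

expScaled⁺-suc-large : ∀ k N → 2 * k ≤ suc N → expScaled⁺ k (suc N) ≤ suc N * expScaled⁺ k N
expScaled⁺-suc-large k N 2k≤1+N = begin
    suc N * E + k * P + 2 * (k * P)  ≡⟨ collect N k E P ⟩
    suc N * E + (3 * k) * P          ≤⟨ +-monoʳ-≤ (suc N * E) (*-monoˡ-≤ P 3k≤2[1+N]) ⟩
    suc N * E + (2 * suc N) * P      ≡⟨ factor N E P ⟩
    suc N * (E + 2 * P)              ∎
  where
  open ≤-Reasoning
  E = expScaled k N
  P = k ^ N
  3k≤2[1+N] : 3 * k ≤ 2 * suc N
  3k≤2[1+N] = ≤-trans (≤-trans (≤-reflexive (three k)) (m≤m+n (2 * k + k) k))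
                      (≤-trans (≤-reflexive (four k)) (*-monoʳ-≤ 2 2k≤1+N))
    where
    three : ∀ k → 3 * k ≡ 2 * k + k
    three = solve-∀
    four : ∀ k → 2 * k + k + k ≡ 2 * (2 * k)
    four = solve-∀
  collect : ∀ N k E P → suc N * E + k * P + 2 * (k * P) ≡ suc N * E + (3 * k) * P
  collect = solve-∀
  factor : ∀ N E P → suc N * E + (2 * suc N) * P ≡ suc N * (E + 2 * P)
  factor = solve-∀

expScaled⁺-small : ∀ k N → expScaled⁺ k N ≤ 3 * (3 * k + 1) ^ N * N !
expScaled⁺-small k zero    = ≤-refl
expScaled⁺-small k (suc N) = begin
    expScaled⁺ k (suc N)                                 ≤⟨ expScaled⁺-suc k N ⟩
    suc N * (3 * k + 1) * expScaled⁺ k N                 ≤⟨ *-monoʳ-≤ (suc N * (3 * k + 1)) (expScaled⁺-small k N) ⟩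
    suc N * (3 * k + 1) * (3 * (3 * k + 1) ^ N * N !)    ≡⟨ rearrange N (3 * k + 1) ((3 * k + 1) ^ N) (N !) ⟩
    3 * ((3 * k + 1) * (3 * k + 1) ^ N) * (suc N * N !)  ∎
  where
  open ≤-Reasoning
  rearrange : ∀ N q Q f → suc N * q * (3 * Q * f) ≡ 3 * (q * Q) * (suc N * f)
  rearrange = solve-∀

expBound : ℕ → ℕ
expBound k = 3 * (3 * k + 1) ^ (2 * k)

expScaled⁺-large : ∀ k t → expScaled⁺ k (2 * k + t) ≤ expBound k * (2 * k + t) !
expScaled⁺-large k zero    =
  subst (λ z → expScaled⁺ k z ≤ expBound k * z !) (sym (+-identityʳ (2 * k))) (expScaled⁺-small k (2 * k))
expScaled⁺-large k (suc t) = subst (λ z → expScaled⁺ k z ≤ expBound k * z !) (sym (+-suc (2 * k) t)) (begin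
    expScaled⁺ k (suc N)               ≤⟨ expScaled⁺-suc-large k N (≤-trans (m≤m+n (2 * k) t) (n≤1+n _)) ⟩
    suc N * expScaled⁺ k N             ≤⟨ *-monoʳ-≤ (suc N) (expScaled⁺-large k t) ⟩
    suc N * (expBound k * N !)         ≡⟨ *-left-comm (suc N) (expBound k) (N !) ⟩
    expBound k * (suc N * N !)         ∎)
  where
  open ≤-Reasoning
  N = 2 * k + t
  *-left-comm : ∀ x y z → x * (y * z) ≡ y * (x * z)
  *-left-comm = solve-∀

expScaled≤expBound*! : ∀ k N → expScaled k N ≤ expBound k * N !
expScaled≤expBound*! k N = ≤-trans (m≤m+n _ _) (bound (N ≤? 2 * k))
  where
  bound : Dec (N ≤ 2 * k) → expScaled⁺ k N ≤ expBound k * N !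
  bound (yes N≤2k) = ≤-trans (expScaled⁺-small k N) (*-monoˡ-≤ (N !) (*-monoʳ-≤ 3 (^-monoʳ-≤ (3 * k + 1) N≤2k)))
    where instance _ : NonZero (3 * k + 1)
                   _ = subst NonZero (+-comm 1 (3 * k)) _
  bound (no N≰2k) = subst (λ z → expScaled⁺ k z ≤ expBound k * z !) (m+[n∸m]≡n (<⇒≤ (≰⇒> N≰2k)))
                          (expScaled⁺-large k (N ∸ 2 * k))

-- Past this many vertices, every difference d < K is almost equitable.
equitableThreshold : ℕ → ℕ
equitableThreshold K = sumFrom (λ d → expBound (d * d)) 0 K

3≤equitableThreshold : ∀ K → 3 ≤ equitableThreshold (suc K)
3≤equitableThreshold K = m≤m+n 3 (sumFrom (λ d → expBound (d * d)) 1 K)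

module _ {ae : ℕ → ℕ → Bool} (spec : AESpec ae) where

  ae-below-threshold : ∀ {n d K} → d < K → equitableThreshold K ≤ n → T (ae n d)
  ae-below-threshold {n} {d} {K} d<K K≤n = Equivalence.from (spec n d) λ N →
    ≤-trans (expScaled≤expBound*! (d * d) N)
            (*-monoˡ-≤ (N !) (≤-trans (term≤sumFrom (λ d → expBound (d * d)) 0 K d d<K) K≤n))

  ¬ae⇒threshold≤ : ∀ {n d K} → ae n d ≡ false → equitableThreshold K ≤ n → K ≤ d
  ¬ae⇒threshold≤ {n} {d} {K} ¬ae K≤n with d <? K
  ... | yes d<K = ⊥-elim (subst T ¬ae (ae-below-threshold d<K K≤n))
  ... | no  d≮K = ≮⇒≥ d≮K

⌈n/2⌉≤1+⌊n/2⌋ : ∀ n → ⌈ n /2⌉ ≤ suc ⌊ n /2⌋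
⌈n/2⌉≤1+⌊n/2⌋ zero          = z≤n
⌈n/2⌉≤1+⌊n/2⌋ (suc zero)    = ≤-refl
⌈n/2⌉≤1+⌊n/2⌋ (suc (suc n)) = s≤s (⌈n/2⌉≤1+⌊n/2⌋ n)

⌊n/2⌋<n⁺ : ∀ {n} → 1 ≤ n → ⌊ n /2⌋ < n
⌊n/2⌋<n⁺ {suc n} _ = ⌊n/2⌋<n n

n∸⌈n/2⌉≡⌊n/2⌋ : ∀ n → n ∸ ⌈ n /2⌉ ≡ ⌊ n /2⌋
n∸⌈n/2⌉≡⌊n/2⌋ n = trans (cong (_∸ ⌈ n /2⌉) (sym (⌊n/2⌋+⌈n/2⌉≡n n))) (m+n∸n≡m ⌊ n /2⌋ ⌈ n /2⌉)

n≤⌈n/2⌉+⌈n/2⌉ : ∀ n → n ≤ ⌈ n /2⌉ + ⌈ n /2⌉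
n≤⌈n/2⌉+⌈n/2⌉ n = subst (_≤ ⌈ n /2⌉ + ⌈ n /2⌉) (⌊n/2⌋+⌈n/2⌉≡n n) (+-monoˡ-≤ ⌈ n /2⌉ (⌊n/2⌋≤⌈n/2⌉ n))

⌈n/2⌉+⌈n/2⌉≤1+n : ∀ n → ⌈ n /2⌉ + ⌈ n /2⌉ ≤ suc n
⌈n/2⌉+⌈n/2⌉≤1+n n = subst (⌈ n /2⌉ + ⌈ n /2⌉ ≤_) (cong suc (⌊n/2⌋+⌈n/2⌉≡n n)) (+-monoˡ-≤ ⌈ n /2⌉ (⌈n/2⌉≤1+⌊n/2⌋ n))

∣⌈n/2⌉-⌊n/2⌋∣≤1 : ∀ n → ∣ ⌈ n /2⌉ - ⌊ n /2⌋ ∣ ≤ 1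
∣⌈n/2⌉-⌊n/2⌋∣≤1 n = subst (_≤ 1) (sym (m≤n⇒∣n-m∣≡n∸m (⌊n/2⌋≤⌈n/2⌉ n)))
  (m≤n+o⇒m∸n≤o ⌈ n /2⌉ ⌊ n /2⌋ (subst (⌈ n /2⌉ ≤_) (+-comm 1 ⌊ n /2⌋) (⌈n/2⌉≤1+⌊n/2⌋ n)))

balanced-innerPairs≤crossPairs : ∀ b c → b ≤ c → c ≤ suc b → binom c 2 + binom b 2 ≤ c * b
balanced-innerPairs≤crossPairs b c b≤c c≤1+b with m≤n⇒m<n∨m≡n b≤c
... | inj₂ refl = 2*binom[h,2]≤h*h b
... | inj₁ b<c rewrite ≤-antisym c≤1+b b<c = begin
    binom (suc b) 2 + binom b 2    ≡⟨ cong (_+ binom b 2) (binom[1+n,2] b) ⟩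
    b + binom b 2 + binom b 2      ≡⟨ rearrange b (binom b 2) ⟩
    2 * binom b 2 + b              ≡⟨ 2*binom[h,2]+h≡h*h b ⟩
    b * b                          ≤⟨ m≤n+m (b * b) b ⟩
    suc b * b                      ∎
  where
  open ≤-Reasoning
  rearrange : ∀ b B → b + B + B ≡ 2 * B + b
  rearrange = solve-∀

far-from-centre : ∀ a n c K' → a ≤ n → n < a + a → suc (suc (K' + K')) ≤ ∣ a - (n ∸ a) ∣ →
  c + c ≤ suc n → c + K' ≤ a
far-from-centre a n c K' a≤n n<2a 2K'+2≤∣a-b∣ 2c≤1+n = ≮⇒≥ a≮c+K'
  where
  x = K' + K'
  b≤a : n ∸ a ≤ a
  b≤a = m≤n+o⇒m∸n≤o n a (<⇒≤ n<2a)
  2K'+2+n≤2a : suc (suc x) + n ≤ a + a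
  2K'+2+n≤2a = begin
    suc (suc x) + n                ≡⟨ cong (suc (suc x) +_) (sym (m∸n+n≡m a≤n)) ⟩
    suc (suc x) + ((n ∸ a) + a)    ≡⟨ sym (+-assoc (suc (suc x)) (n ∸ a) a) ⟩
    suc (suc x) + (n ∸ a) + a      ≤⟨ +-monoˡ-≤ a (m≤o∸n⇒m+n≤o (suc (suc x)) b≤a
                                        (subst (suc (suc x) ≤_) (m≤n⇒∣n-m∣≡n∸m b≤a) 2K'+2≤∣a-b∣)) ⟩
    a + a                          ∎
    where open ≤-Reasoning
  a≮c+K' : ¬ (a < c + K')
  a≮c+K' 1+a≤c+K' = <-irrefl refl (begin-strict
      suc (n + x)                  <⟨ s≤s (s≤s (≤-trans (n≤1+n (n + x)) (n≤1+n (suc (n + x))))) ⟩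
      suc (suc (suc (suc (n + x)))) ≡⟨ rearrange₁ n x ⟩
      suc (suc (suc (suc x) + n))  ≤⟨ s≤s (s≤s 2K'+2+n≤2a) ⟩
      suc (suc (a + a))            ≡⟨ rearrange₂ a ⟩
      suc a + suc a                ≤⟨ +-mono-≤ 1+a≤c+K' 1+a≤c+K' ⟩
      (c + K') + (c + K')          ≡⟨ rearrange₃ c K' ⟩
      (c + c) + x                  ≤⟨ +-monoˡ-≤ x 2c≤1+n ⟩
      suc n + x                    ∎)
    where
    open ≤-Reasoning
    rearrange₁ : ∀ n x → suc (suc (suc (suc (n + x)))) ≡ suc (suc (suc (suc x) + n))
    rearrange₁ = solve-∀
    rearrange₂ : ∀ a → suc (suc (a + a)) ≡ suc a + suc a
    rearrange₂ = solve-∀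
    rearrange₃ : ∀ c K' → (c + K') + (c + K') ≡ (c + c) + (K' + K')
    rearrange₃ = solve-∀

countTrueV<k⇒anyFalse : ∀ {k} (v : Vec Bool k) → countTrueV v < k → anyFalse v ≡ true
countTrueV<k⇒anyFalse (true  ∷v v) (s≤s lt) = countTrueV<k⇒anyFalse v lt
countTrueV<k⇒anyFalse (false ∷v v) _        = refl

*-pos : ∀ {x y} → 0 < x → 0 < y → 0 < x * y
*-pos {suc x} {suc y} _ _ = s≤s z≤n

module Decomposition {ae : ℕ → ℕ → Bool} (n m : ℕ) where

  equitable : ℕ → Bool
  equitable a = ae n ∣ a - (n ∸ a) ∣

  equitablePart : Vec Bool n → ℕ
  equitablePart s = if canonical s ∧ equitable (countTrueV s) then coversOfSize n m (countTrueV s) else 0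

  otherPart : Vec Bool n → ℕ
  otherPart s = if canonical s ∧ not (equitable (countTrueV s)) then coversOfSize n m (countTrueV s) else 0

  equitableSum : ℕ
  equitableSum = sum (map equitablePart (allSides n))

  otherSum : ℕ
  otherSum = sum (map otherPart (allSides n))

  aeSum≡equitableSum : aeSum ae n m ≡ equitableSum
  aeSum≡equitableSum = sum-map-cong (allSides n) (λ s →
    cong (λ x → if canonical s ∧ equitable (countTrueV s) then x else 0)
         (crossTerm≡covers (countTrueV s) (n ∸ countTrueV s) m))

  covCount≡equitableSum+otherSum : covCount n m ≡ equitableSum + otherSum
  covCount≡equitableSum+otherSum = begin
      covCount n m
        ≡⟨ covCount≡ n m ⟩
      sum (map (λ s → if canonical s then coversOfSize n m (countTrueV s) else 0) (allSides n))
        ≡⟨ sum-map-cong (allSides n) (λ s → split (canonical s) (equitable (countTrueV s)) (coversOfSize n m (countTrueV s))) ⟩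
      sum (map (λ s → equitablePart s + otherPart s) (allSides n))
        ≡⟨ sum-map-+ equitablePart otherPart (allSides n) ⟩
      equitableSum + otherSum ∎
    where
    open ≡-Reasoning
    split : ∀ b e x → (if b then x else 0) ≡ (if b ∧ e then x else 0) + (if b ∧ not e then x else 0)
    split true  true  x = sym (+-identityʳ x)
    split true  false x = refl
    split false e     x = refl

  otherWeight : ℕ → ℕ
  otherWeight a = if not (equitable a) then coversOfSize n m a else 0

  otherSum≤ : otherSum ≤ sumFrom (λ a → binom n a * otherWeight a) 0 (suc n)
  otherSum≤ = ≤-trans
    (sum-map-mono (allSides n) (λ s → drop-canonical (canonical s) (equitable (countTrueV s)) (coversOfSize n m (countTrueV s))))
    (≤-reflexive (sum-allSides-countTrueV n otherWeight))
    where
    drop-canonical : ∀ b e x → (if b ∧ not e then x else 0) ≤ (if not e then x else 0)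
    drop-canonical true  e x = ≤-refl
    drop-canonical false e x = z≤n

  otherWeight-complement : ∀ a → a ≤ n → otherWeight (n ∸ a) ≡ otherWeight a
  otherWeight-complement a a≤n = cong₂ (λ u v → if not (ae n u) then v else 0)
     (trans (cong (λ z → ∣ (n ∸ a) - z ∣) (m∸[m∸n]≡n a≤n)) (∣-∣-comm (n ∸ a) a))
     (trans (cong (λ z → covers (n ∸ a) z m) (m∸[m∸n]≡n a≤n)) (covers-comm (n ∸ a) a m))

  largerPartWeight : ℕ → ℕ
  largerPartWeight a = if n <ᵇ a + a then otherWeight a else 0

  otherWeight≤ : T (ae n 0) → ∀ a → a ≤ n → otherWeight a ≤ largerPartWeight a + largerPartWeight (n ∸ a)
  otherWeight≤ ae0 a a≤n with n <? a + a
  ... | yes n<2a = ≤-trans (≤-reflexive (sym (if-T (<⇒<ᵇ n<2a)))) (m≤m+n _ _)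
  ... | no n≮2a with a + a <? n
  ...   | yes 2a<n =
    ≤-trans (≤-reflexive (trans (sym (otherWeight-complement a a≤n)) (sym (if-T (<⇒<ᵇ n<2b))))) (m≤n+m _ _)
    where
    b = n ∸ a
    a+b≡n : a + b ≡ n
    a+b≡n = m+[n∸m]≡n a≤n
    n<2b : n < b + b
    n<2b = subst (_< b + b) a+b≡n (+-monoˡ-< b (+-cancelˡ-< a a b (subst (a + a <_) (sym a+b≡n) 2a<n)))
  ...   | no 2a≮n rewrite sym (≤-antisym (≮⇒≥ n≮2a) (≮⇒≥ 2a≮n)) | m+n∸m≡n a a | ∣n-n∣≡0 a
                        | Equivalence.to T-≡ ae0 = z≤n

  -- Complementation preserves the type of a bipartition, so only the larger part needs counting.
  otherSum≤2*largerParts : T (ae n 0) → otherSum ≤ 2 * sumFrom (λ a → binom n a * largerPartWeight a) 0 (suc n)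
  otherSum≤2*largerParts ae0 = begin
      otherSum
        ≤⟨ otherSum≤ ⟩
      sumFrom (λ a → binom n a * otherWeight a) 0 (suc n)
        ≤⟨ sumFrom-mono 0 (suc n) (λ i i≤n → ≤-trans (*-monoʳ-≤ (binom n i) (otherWeight≤ ae0 i (s≤s⁻¹ i≤n)))
                                                   (≤-reflexive (*-distribˡ-+ (binom n i) _ _))) ⟩
      sumFrom (λ a → binom n a * largerPartWeight a + binom n a * largerPartWeight (n ∸ a)) 0 (suc n)
        ≡⟨ sumFrom-+ (λ a → binom n a * largerPartWeight a) (λ a → binom n a * largerPartWeight (n ∸ a)) 0 (suc n) ⟩
      L + sumFrom (λ a → binom n a * largerPartWeight (n ∸ a)) 0 (suc n)
        ≡⟨ cong (L +_) (binomSum-complement n largerPartWeight) ⟩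
      L + L
        ≡⟨ cong (L +_) (sym (+-identityʳ L)) ⟩
      2 * L ∎
    where
    open ≤-Reasoning
    L = sumFrom (λ a → binom n a * largerPartWeight a) 0 (suc n)

-- The non-equitable bipartitions are negligible

module Negligible {ae : ℕ → ℕ → Bool} (spec : AESpec ae) (n′ m j K′ : ℕ)
  (m≤ : suc j * m ≤ binom (suc n′) 2 * j)
  (m≥ : binom (suc n′) 2 * (j + 3) ≤ 2 * suc j * m)
  (n-large : equitableThreshold (suc (suc (K′ + K′))) ≤ suc n′) where

  n = suc n′
  K = suc (suc (K′ + K′))
  open Decomposition {ae} n m

  -- c = ⌈n/2⌉ = 1 + ⌊n′/2⌋ is the size of the part containing vertex 0 in a central bipartition.
  c′ = ⌊ n′ /2⌋
  c = suc c′

  1≤n′ : 1 ≤ n′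
  1≤n′ = ≤-trans (s≤s z≤n) (s≤s⁻¹ (≤-trans (3≤equitableThreshold (suc (K′ + K′))) n-large))

  c′<n′ : c′ < n′
  c′<n′ = ⌊n/2⌋<n⁺ 1≤n′

  ae0 : T (ae n 0)
  ae0 = ae-below-threshold spec {K = K} (s≤s z≤n) n-large

  equitable-centre : equitable c ≡ true
  equitable-centre = Equivalence.to T-≡ (ae-below-threshold spec {K = K}
    (≤-trans (s≤s (subst (λ z → ∣ c - z ∣ ≤ 1) (sym (n∸⌈n/2⌉≡⌊n/2⌋ n)) (∣⌈n/2⌉-⌊n/2⌋∣≤1 n))) (s≤s (s≤s z≤n)))
    n-large)

  weight-ratio-beyond-centre : ∀ a → c ≤ a → weight n m (suc a) * suc j ≤ weight n m a * j
  weight-ratio-beyond-centre a c≤a = weight-ratio n m j a m≤ (≤-trans (n≤⌈n/2⌉+⌈n/2⌉ n) (+-mono-≤ c≤a c≤a))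

  largerPart≤far : ∀ a → a ≤ n → binom n a * largerPartWeight a ≤ (if c + K′ ≤ᵇ a then weight n m a else 0)
  largerPart≤far a a≤n with n <? a + a
  ... | no n≮2a rewrite ¬T⇒≡false (λ t → n≮2a (<ᵇ⇒< n (a + a) t)) | *-zeroʳ (binom n a) = z≤n
  ... | yes n<2a rewrite Equivalence.to T-≡ (<⇒<ᵇ n<2a) = byType (equitable a) refl
    where
    byType : ∀ e → equitable a ≡ e → binom n a * otherWeight a ≤ (if c + K′ ≤ᵇ a then weight n m a else 0)
    byType true  e rewrite e | *-zeroʳ (binom n a) = z≤n
    byType false e rewrite e = ≤-reflexive (sym (if-T (≤⇒≤ᵇ
      (far-from-centre a n c K′ a≤n n<2a (¬ae⇒threshold≤ spec {K = K} e n-large) (⌈n/2⌉+⌈n/2⌉≤1+n n)))))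

  otherSum≤tail : otherSum ≤ 2 * (weight n m (c + K′) * suc j)
  otherSum≤tail = ≤-trans (otherSum≤2*largerParts ae0) (*-monoʳ-≤ 2 (begin
      sumFrom (λ a → binom n a * largerPartWeight a) 0 (suc n)
        ≤⟨ sumFrom-mono 0 (suc n) (λ i i≤n → largerPart≤far i (s≤s⁻¹ i≤n)) ⟩
      sumFrom (λ a → if c + K′ ≤ᵇ a then weight n m a else 0) 0 (suc n)
        ≤⟨ sumFrom-restrict (weight n m) (c + K′) (suc n) 0 z≤n ⟩
      sumFrom (weight n m) (c + K′) (suc n)
        ≤⟨ geometric-tail (weight n m) j c weight-ratio-beyond-centre (suc n) (c + K′) (m≤m+n c K′) ⟩
      weight n m (c + K′) * suc j ∎))
    where open ≤-Reasoning

  X*weight-far≤weight-centre : ∀ X → X * suc j ≤ K′ → X * weight n m (c + K′) ≤ weight n m c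
  X*weight-far≤weight-centre X X[1+j]≤K′ =
    *-cancelʳ-≤ (X * weight n m (c + K′)) (weight n m c) (suc j ^ K′) {{m^n≢0 (suc j) K′}} (begin
      X * weight n m (c + K′) * suc j ^ K′    ≡⟨ *-assoc X _ (suc j ^ K′) ⟩
      X * (weight n m (c + K′) * suc j ^ K′)  ≤⟨ *-monoʳ-≤ X (geometric-decay (weight n m) j c weight-ratio-beyond-centre K′) ⟩
      X * (weight n m c * j ^ K′)             ≡⟨ *-left-comm X (weight n m c) (j ^ K′) ⟩
      weight n m c * (X * j ^ K′)             ≤⟨ *-monoʳ-≤ (weight n m c) (X*P^t≤[1+P]^t j X K′ X[1+j]≤K′) ⟩
      weight n m c * suc j ^ K′               ∎)
    where
    open ≤-Reasoning
    *-left-comm : ∀ x y z → x * (y * z) ≡ y * (x * z)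
    *-left-comm = solve-∀

  -- The bipartitions with 0 ∈ A and |A| = c are C(n′, c′) of the C(n, c) ≤ 2·C(n′, c′) ones.
  centreTerms≤equitableSum : binom n′ c′ * coversOfSize n m c ≤ equitableSum
  centreTerms≤equitableSum = begin
      binom n′ c′ * coversOfSize n m c                              ≡⟨ cong (binom n′ c′ *_) (sym (if-T {y = 0} (≡⇒≡ᵇ c′ c′ refl))) ⟩
      binom n′ c′ * atCentre c′                                     ≤⟨ term≤sumFrom (λ a → binom n′ a * atCentre a) 0 (suc n′) c′ (≤-trans c′<n′ (n≤1+n n′)) ⟩
      sumFrom (λ a → binom n′ a * atCentre a) 0 (suc n′)            ≡⟨ sym (sum-allSides-countTrueV n′ atCentre) ⟩
      sum (map (λ v → atCentre (countTrueV v)) (allSides n′))       ≤⟨ sum-map-mono (allSides n′) atCentre≤ ⟩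
      sum (map (λ v → equitablePart (true ∷v v)) (allSides n′))     ≤⟨ sum-map-mono (allSides n′) (λ v → m≤m+n _ (equitablePart (false ∷v v))) ⟩
      sum (map (λ v → equitablePart (true ∷v v) + equitablePart (false ∷v v)) (allSides n′))
                                                                    ≡⟨ sym (sum-map-concatMap-pair equitablePart (true ∷v_) (false ∷v_) (allSides n′)) ⟩
      equitableSum                                                  ∎
    where
    open ≤-Reasoning
    atCentre : ℕ → ℕ
    atCentre x = if x ≡ᵇ c′ then coversOfSize n m c else 0
    atCentre≤ : ∀ v → atCentre (countTrueV v) ≤ equitablePart (true ∷v v)
    atCentre≤ v with countTrueV v ≟ c′
    ... | yes ≡c′ rewrite countTrueV<k⇒anyFalse v (subst (_< n′) (sym ≡c′) c′<n′) | ≡c′ | equitable-centre =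
      if-≤ (c′ ≡ᵇ c′) _
    ... | no  ≢c′  rewrite ¬T⇒≡false (λ t → ≢c′ (≡ᵇ⇒≡ (countTrueV v) c′ t)) = z≤n

  weight-centre≤ : weight n m c ≤ 2 * equitableSum
  weight-centre≤ = begin
      binom n c * coversOfSize n m c                       ≤⟨ *-monoˡ-≤ (coversOfSize n m c) binom-centre≤ ⟩
      (binom n′ c′ + (binom n′ c′ + 0)) * coversOfSize n m c ≡⟨ *-assoc 2 (binom n′ c′) _ ⟩
      2 * (binom n′ c′ * coversOfSize n m c)               ≤⟨ *-monoʳ-≤ 2 centreTerms≤equitableSum ⟩
      2 * equitableSum                                     ∎
    where
    open ≤-Reasoning
    n′∸c′≤1+c′ : n′ ∸ c′ ≤ suc c′
    n′∸c′≤1+c′ = subst (_≤ suc c′) (sym (trans (cong (_∸ c′) (sym (⌊n/2⌋+⌈n/2⌉≡n n′))) (m+n∸m≡n c′ ⌈ n′ /2⌉)))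
                       (⌈n/2⌉≤1+⌊n/2⌋ n′)
    binom-centre≤ : binom n c ≤ binom n′ c′ + (binom n′ c′ + 0)
    binom-centre≤ = +-monoʳ-≤ (binom n′ c′) (≤-trans (binom-suc≤binom n′ c′ n′∸c′≤1+c′) (≤-reflexive (sym (+-identityʳ _))))

  -- The lower bound on m leaves room for every inner pair of the central bipartition.
  coversOfSize-centre>0 : 0 < coversOfSize n m c
  coversOfSize-centre>0 = subst (0 <_) (sym (covers-above c b m I≤m)) (k≤n⇒binom>0 (c * b) (m ∸ I) m∸I≤cb)
    where
    b = n ∸ c
    I = binom c 2 + binom b 2
    b≡⌊n/2⌋ : b ≡ ⌊ n /2⌋
    b≡⌊n/2⌋ = n∸⌈n/2⌉≡⌊n/2⌋ n
    I≤cb : I ≤ c * b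
    I≤cb = subst (λ z → binom c 2 + binom z 2 ≤ c * z) (sym b≡⌊n/2⌋)
      (balanced-innerPairs≤crossPairs ⌊ n /2⌋ c (⌊n/2⌋≤⌈n/2⌉ n) (⌈n/2⌉≤1+⌊n/2⌋ n))
    n-split : binom n 2 ≡ c * b + I
    n-split = trans (cong (λ z → binom z 2) (sym (m+[n∸m]≡n (⌈n/2⌉≤n n)))) (binom[a+b,2] c b)
    m≤binom : m ≤ binom n 2
    m≤binom = *-cancelˡ-≤ (suc j) (≤-trans m≤ (≤-trans (*-monoʳ-≤ (binom n 2) (n≤1+n j)) (≤-reflexive (*-comm (binom n 2) (suc j)))))
    I≤m : I ≤ m
    I≤m = *-cancelˡ-≤ (2 * suc j) (begin
      2 * suc j * I        ≡⟨ double j I ⟩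
      suc j * (I + I)      ≤⟨ *-monoʳ-≤ (suc j) (≤-trans (+-monoˡ-≤ I I≤cb) (≤-reflexive (sym n-split))) ⟩
      suc j * binom n 2    ≤⟨ *-monoˡ-≤ (binom n 2) (≤-trans (n≤1+n (suc j)) (≤-trans (n≤1+n _) (≤-reflexive (+-comm 3 j)))) ⟩
      (j + 3) * binom n 2  ≡⟨ *-comm (j + 3) (binom n 2) ⟩
      binom n 2 * (j + 3)  ≤⟨ m≥ ⟩
      2 * suc j * m        ∎)
      where
      open ≤-Reasoning
      double : ∀ j I → 2 * suc j * I ≡ suc j * (I + I)
      double = solve-∀
    m∸I≤cb : m ∸ I ≤ c * b
    m∸I≤cb = ≤-trans (∸-monoˡ-≤ I m≤binom) (≤-reflexive (trans (cong (_∸ I) n-split) (m+n∸n≡m (c * b) I)))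

  equitableSum>0 : 0 < equitableSum
  equitableSum>0 = ≤-trans (*-pos (k≤n⇒binom>0 n′ c′ (<⇒≤ c′<n′)) coversOfSize-centre>0) centreTerms≤equitableSum

  otherSum-negligible : ∀ k → 4 * suc j * suc k * suc j ≤ K′ → otherSum * suc k ≤ equitableSum
  otherSum-negligible k K′-large = *-cancelˡ-≤ 2 (begin
      2 * (otherSum * suc k)                          ≤⟨ *-monoʳ-≤ 2 (*-monoˡ-≤ (suc k) otherSum≤tail) ⟩
      2 * (2 * (weight n m (c + K′) * suc j) * suc k) ≡⟨ rearrange j k (weight n m (c + K′)) ⟩
      (4 * suc j * suc k) * weight n m (c + K′)       ≤⟨ X*weight-far≤weight-centre (4 * suc j * suc k) K′-large ⟩
      weight n m c                                    ≤⟨ weight-centre≤ ⟩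
      2 * equitableSum                                ∎)
    where
    open ≤-Reasoning
    rearrange : ∀ j k w → 2 * (2 * (w * suc j) * suc k) ≡ (4 * suc j * suc k) * w
    rearrange = solve-∀

density-bounds : ∀ j p m → (p C 2) * (j + 3) ≤ 2 * suc j * m → 2 * suc j * m ≤ (p C 2) * (2 * j) →
  (suc j * m ≤ binom p 2 * j) × (binom p 2 * (j + 3) ≤ 2 * suc j * m)
density-bounds j p m lower upper rewrite C≡binom p 2 = halve , lower
  where
  halve : suc j * m ≤ binom p 2 * j
  halve = *-cancelˡ-≤ 2 (begin
      2 * (suc j * m)        ≡⟨ sym (*-assoc 2 (suc j) m) ⟩
      2 * suc j * m          ≤⟨ upper ⟩
      binom p 2 * (2 * j)    ≡⟨ *-left-comm (binom p 2) 2 j ⟩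
      2 * (binom p 2 * j)    ∎)
    where
    open ≤-Reasoning
    *-left-comm : ∀ x y z → x * (y * z) ≡ y * (x * z)
    *-left-comm = solve-∀

-- Bernoulli's inequality turns K′ = slack j k into 4(j+1)(k+1)·(j/(j+1))^K′ ≤ 1.
slack : ℕ → ℕ → ℕ
slack j k = 4 * suc j * suc k * suc j

equitable-dominates : ∀ {ae} → AESpec ae → ∀ j k n′ m →
  (suc n′ C 2) * (j + 3) ≤ 2 * suc j * m → 2 * suc j * m ≤ (suc n′ C 2) * (2 * j) →
  equitableThreshold (suc (suc (slack j k + slack j k))) ≤ suc n′ →
  (0 < aeSum ae (suc n′) m) × (∣ covCount (suc n′) m - aeSum ae (suc n′) m ∣ * suc k ≤ aeSum ae (suc n′) m)
equitable-dominates {ae} spec j k n′ m lower upper n-large =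
    subst (0 <_) (sym aeSum≡equitableSum) equitableSum>0
  , subst₂ (λ u v → ∣ u - v ∣ * suc k ≤ v) (sym covCount≡equitableSum+otherSum) (sym aeSum≡equitableSum)
      (subst (λ z → z * suc k ≤ equitableSum)
             (sym (trans (∣-∣-comm (equitableSum + otherSum) equitableSum) (∣m-m+n∣≡n equitableSum otherSum)))
             (otherSum-negligible k ≤-refl))
  where
  bounds = density-bounds j (suc n′) m lower upper
  open Negligible spec n′ m j (slack j k) (proj₁ bounds) (proj₂ bounds) n-large
  open Decomposition {ae} (suc n′) m

-- Only the eventual bounds 1/2 < m/C(n,2) < 1 of GammaHyp are needed, not the convergence of the ratio.
lemmaC2 : (m : ℕ → ℕ) → GammaHyp m →
    (ae : ℕ → ℕ → Bool) → AESpec ae →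
    Asymp (λ n → covCount n (m n)) (λ n → aeSum ae n (m n))
lemmaC2 m (_ , (j , N₀ , bounds)) ae spec =
  (N 0 , λ n N≤n → proj₁ (dominates 0 n N≤n)) , λ k → N k , λ n N≤n → proj₂ (dominates k n N≤n)
  where
  N : ℕ → ℕ
  N k = N₀ + equitableThreshold (suc (suc (slack j k + slack j k)))
  dominates : ∀ k n → N k ≤ n →
    (0 < aeSum ae n (m n)) × (∣ covCount n (m n) - aeSum ae n (m n) ∣ * suc k ≤ aeSum ae n (m n))
  dominates k zero N≤0 = ⊥-elim (3≰0 (≤-trans (3≤equitableThreshold (suc (slack j k + slack j k)))
    (≤-trans (m≤n+m (equitableThreshold (suc (suc (slack j k + slack j k)))) N₀) N≤0)))
    where
    3≰0 : ¬ 3 ≤ 0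
    3≰0 ()
  dominates k (suc n′) N≤n = equitable-dominates spec j k n′ (m (suc n′))
    (proj₁ (bounds (suc n′) N₀≤n)) (proj₂ (bounds (suc n′) N₀≤n))
    (≤-trans (m≤n+m (equitableThreshold (suc (suc (slack j k + slack j k)))) N₀) N≤n)
    where
    N₀≤n : N₀ ≤ suc n′
    N₀≤n = ≤-trans (m≤m+n N₀ (equitableThreshold (suc (suc (slack j k + slack j k))))) N≤n
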